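{- If $s=(s_1,\dots,s_n)$ is an up-split sequence, then $s_n=2n-2$.
   Context: Down-split sequences $(s_2,\dots,s_m)$ (increasing positive integers, indexed from $2$): $(1)$ is down-split; for $m>2$, $s$ is down-split if $\{2\le k<m:s_k=2k-2\}\neq\emptyset$ and, with $k_s$ its minimum, $(s_2-1,\dots,s_{k_s}-1)$ and $(s_{k_s+1}-(2k_s-2),\dots,s_m-(2k_s-2))$ are down-split (re-indexed from $2$). Up-split sequences are increasing sequences of nonnegative integers $s=(s_1,\dots,s_n)$ defined recursively: $(0)$ (with $n=1$) is up-split; for $n>1$, $s$ is up-split if $\{1\le k<n:s_k=2k-2\}\neq\emptyset$ and, with $k_s$ its maximum (the splitting index), $(s_1,\dots,s_{k_s})$ is up-split and $(s_{k_s+1}-(2k_s-1),\dots,s_n-(2k_s-1))$ is down-split (indexed from $2$). -}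

module Defs where

open import Data.Nat using (ℕ; zero; suc; _+_; _*_; _∸_; _<_)
open import Data.List using (List; []; _∷_; length; map; take; drop)
open import Data.List.Relation.Unary.All using (All)
open import Data.List.Relation.Unary.Linked using (Linked)
open import Data.Maybe using (Maybe; just; nothing)
open import Relation.Binary.PropositionalEquality using (_≡_; _≢_)

at : List ℕ → ℕ → Maybe ℕ
at []       _       = nothing
at (x ∷ xs) zero    = just x
at (x ∷ xs) (suc i) = at xs i

Increasing : List ℕ → Set
Increasing = Linked _<_

-- Down-split sequences (s_2,…,s_m) are stored as lists; the entry at 0-based
-- position i is s_{i+2}.  The condition s_k = 2k-2 for k = i+2 reads
-- at xs i ≡ just (2i+2); 2 ≤ k < m reads suc i < length xs.
-- k_s is the minimum such k; the left part (s_2-1,…,s_k-1) is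
-- map (_∸ 1) (take (suc i) xs), the right part is
-- map (_∸ (2k-2)) (drop (suc i) xs) with 2k-2 = 2i+2.
data DownSplit : List ℕ → Set where
  down-base : DownSplit (1 ∷ [])
  down-split : (xs : List ℕ) (i : ℕ) →
    Increasing xs →
    All (0 <_) xs →
    suc i < length xs →
    at xs i ≡ just (2 * i + 2) →
    (∀ j → j < i → at xs j ≢ just (2 * j + 2)) →
    DownSplit (map (_∸ 1) (take (suc i) xs)) →
    DownSplit (map (_∸ (2 * i + 2)) (drop (suc i) xs)) →
    DownSplit xs

-- Up-split sequences (s_1,…,s_n) stored as lists; the entry at 0-based
-- position i is s_{i+1}.  The condition s_k = 2k-2 for k = i+1 reads
-- at xs i ≡ just (2i); 1 ≤ k < n reads suc i < length xs.
-- k_s is the maximum such k; left part (s_1,…,s_k) = take (suc i) xs,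
-- right part (s_{k+1}-(2k-1),…) with 2k-1 = 2i+1.
data UpSplit : List ℕ → Set where
  up-base : UpSplit (0 ∷ [])
  up-split : (xs : List ℕ) (i : ℕ) →
    Increasing xs →
    suc i < length xs →
    at xs i ≡ just (2 * i) →
    (∀ j → i < j → suc j < length xs → at xs j ≢ just (2 * j)) →
    UpSplit (take (suc i) xs) →
    DownSplit (map (_∸ (2 * i + 1)) (drop (suc i) xs)) →
    UpSplit xs

-- The last entry of a split sequence is the last entry of its right part, shifted back.
-- By induction a down-split list of length d ends in 2d − 1; this is positive, so the
-- truncated subtraction of the shift can be undone.  After the first k entries, a right
-- part of length d shifted back by 2k (down-split) or 2k − 1 (up-split) therefore ends
-- the whole list of length k + d in 2(k + d) − 1, respectively 2(k + d) − 2.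
module Submission where

open import Defs
open import Data.Nat using (ℕ; zero; suc; _+_; _*_; _∸_; _<_; s<s; z<s)
open import Data.Nat.Properties
  using (+-suc; +-identityʳ; m<m+n; m+n∸m≡n; m≤n⇒∃[o]m+o≡n; *-distribˡ-∸)
open import Data.Nat.Tactic.RingSolver using (solve)
open import Data.List using (List; []; _∷_; length; last; map; drop)
open import Data.List.Properties using (length-map; length-drop; last-map)
open import Data.Maybe using (Maybe; just)
open import Data.Maybe.Properties using (just-injective)
import Data.Maybe as Maybe
open import Data.Product using (∃-syntax; _,_)
open import Relation.Binary.PropositionalEquality
  using (_≡_; refl; sym; trans; cong; subst; module ≡-Reasoning)
open ≡-Reasoning

m<n⇒∃[o]m+1+o≡n : ∀ {m n} → m < n → ∃[ o ] m + suc o ≡ n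
m<n⇒∃[o]m+1+o≡n {m} m<n with o , m+1+o≡n ← m≤n⇒∃[o]m+o≡n m<n =
  o , trans (+-suc m o) m+1+o≡n

m∸n≡1+o⇒m≡1+o+n : ∀ m n {o} → m ∸ n ≡ suc o → m ≡ suc o + n
m∸n≡1+o⇒m≡1+o+n m       zero    eq = trans eq (sym (+-identityʳ _))
m∸n≡1+o⇒m≡1+o+n zero    (suc n) ()
m∸n≡1+o⇒m≡1+o+n (suc m) (suc n) eq =
  trans (cong suc (m∸n≡1+o⇒m≡1+o+n m n eq)) (sym (+-suc _ n))

2*[1+n]∸1≡1+2*n : ∀ n → 2 * suc n ∸ 1 ≡ suc (2 * n)
2*[1+n]∸1≡1+2*n n = +-suc n (n + 0)

2*[1+n]∸2≡2*n : ∀ n → 2 * suc n ∸ 2 ≡ 2 * n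
2*[1+n]∸2≡2*n n = sym (*-distribˡ-∸ 2 (suc n) 1)

last-drop : ∀ {A : Set} k (xs : List A) → k < length xs → last (drop k xs) ≡ last xs
last-drop zero    xs           _         = refl
last-drop (suc k) (x ∷ y ∷ ys) (s<s k<n) = last-drop k (y ∷ ys) k<n

map-∸-just⁻¹ : ∀ {c v} (a : Maybe ℕ) → Maybe.map (_∸ c) a ≡ just (suc v) → a ≡ just (suc v + c)
map-∸-just⁻¹ {c} (just a) eq = cong just (m∸n≡1+o⇒m≡1+o+n a c (just-injective eq))

last-shifted-suffix : ∀ {c v} k (xs : List ℕ) → k < length xs →
  last (map (_∸ c) (drop k xs)) ≡ just (suc v) → last xs ≡ just (suc v + c)
last-shifted-suffix {c} k xs k<n last-suffix = map-∸-just⁻¹ (last xs) (begin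
  Maybe.map (_∸ c) (last xs)            ≡⟨ cong (Maybe.map (_∸ c)) (last-drop k xs k<n) ⟨
  Maybe.map (_∸ c) (last (drop k xs))   ≡⟨ last-map (_∸ c) (drop k xs) ⟨
  last (map (_∸ c) (drop k xs))         ≡⟨ last-suffix ⟩
  just (suc _)                          ∎)

last-from-right-part : ∀ (xs : List ℕ) i e c → suc i + suc e ≡ length xs →
  let right = map (_∸ c) (drop (suc i) xs) in
  last right ≡ just (2 * length right ∸ 1) → last xs ≡ just (suc (2 * e) + c)
last-from-right-part xs i e c n≡ last-right =
  last-shifted-suffix (suc i) xs (subst (suc i <_) n≡ (m<m+n (suc i) z<s)) (begin
    last right                          ≡⟨ last-right ⟩
    just (2 * length right ∸ 1)         ≡⟨ cong (λ d → just (2 * d ∸ 1)) length-right ⟩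
    just (2 * suc e ∸ 1)                ≡⟨ cong just (2*[1+n]∸1≡1+2*n e) ⟩
    just (suc (2 * e))                  ∎)
  where
  right : List ℕ
  right = map (_∸ c) (drop (suc i) xs)

  length-right : length right ≡ suc e
  length-right = begin
    length right                        ≡⟨ length-map (_∸ c) (drop (suc i) xs) ⟩
    length (drop (suc i) xs)            ≡⟨ length-drop (suc i) xs ⟩
    length xs ∸ suc i                   ≡⟨ cong (_∸ suc i) n≡ ⟨
    suc i + suc e ∸ suc i               ≡⟨ m+n∸m≡n (suc i) (suc e) ⟩
    suc e                               ∎

downSplit-last : ∀ {xs} → DownSplit xs → last xs ≡ just (2 * length xs ∸ 1)
downSplit-last down-base = refl
downSplit-last (down-split xs i _ _ i+1<n _ _ _ right)
  with e , n≡ ← m<n⇒∃[o]m+1+o≡n i+1<n =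
  trans (last-from-right-part xs i e (2 * i + 2) n≡ (downSplit-last right)) (cong just (begin
    suc (2 * e) + (2 * i + 2)     ≡⟨ solve (i ∷ e ∷ []) ⟩
    suc (2 * (i + suc e))         ≡⟨ 2*[1+n]∸1≡1+2*n (i + suc e) ⟨
    2 * (suc i + suc e) ∸ 1       ≡⟨ cong (λ n → 2 * n ∸ 1) n≡ ⟩
    2 * length xs ∸ 1             ∎))

lemma6p17 : (s : List ℕ) → UpSplit s →
    last s ≡ just (2 * length s ∸ 2)
lemma6p17 _ up-base = refl
lemma6p17 s (up-split s i _ i+1<n _ _ _ right)
  with e , n≡ ← m<n⇒∃[o]m+1+o≡n i+1<n =
  trans (last-from-right-part s i e (2 * i + 1) n≡ (downSplit-last right)) (cong just (begin
    suc (2 * e) + (2 * i + 1)     ≡⟨ solve (i ∷ e ∷ []) ⟩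
    2 * (i + suc e)               ≡⟨ 2*[1+n]∸2≡2*n (i + suc e) ⟨
    2 * (suc i + suc e) ∸ 2       ≡⟨ cong (λ n → 2 * n ∸ 2) n≡ ⟩
    2 * length s ∸ 2              ∎))
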